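{- For every $n\ge 7$ and every integer $K$ with $2\le K\le \lfloor (n-5)/2\rfloor$, there exists a strong bicentral $2$-tree $G_B$ on $n$ vertices with tail set $\{2,3\}$, maximum degree $\Delta=n-1-K$, and $\sigma(G_B)=3$.
   Context: A $2$-tree is a graph obtained from the triangle $K_3$ by repeatedly adding a new vertex adjacent to both endpoints of an existing edge. For $r\in\{1,2,3\}$ and an integer $\Delta\ge 2$, a $2$-tree on $n$ vertices is $r$-central with maximum degree $\Delta$ if $\Delta$ is its maximum degree and exactly $r$ vertices have degree $\Delta$; these $r$ vertices form the core and the other $n-r$ vertices form the tail. It is strong if the core induces $K_r$. It has tail set $\{2,3\}$ if every tail vertex has degree $2$ or $3$. "Bicentral" means $2$-central. For a strong bicentral $2$-tree $G$ with core vertices $a,b$, let $S(G)=N(a)\cap N(b)\cap (V(G)\setminus\{a,b\})$ and let $\sigma(G)$ be the number of vertices $s\in S(G)$ with $\deg(s)=3$. -}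

module Defs where

open import Data.Nat using (ℕ; zero; suc; _+_; _<_)
open import Data.Bool using (Bool; true; false; _∨_; _∧_; if_then_else_)
open import Data.Fin using (Fin; zero; suc; _≟_)
open import Data.List using (List; map; allFin)
open import Data.Nat.ListAction using (sum)
open import Data.Product using (Σ; _×_; ∃; ∃-syntax)
open import Data.Sum using (_⊎_)
open import Relation.Nullary using (¬_)
open import Relation.Nullary.Decidable using (⌊_⌋)
open import Relation.Binary.PropositionalEquality using (_≡_; _≢_)
import Data.Nat as N

Graph : ℕ → Set
Graph n = Fin n → Fin n → Bool

K3 : Graph 3
K3 i j = Data.Bool.not ⌊ i ≟ j ⌋
  where import Data.Bool

extend : ∀ {n} → Graph n → Fin n → Fin n → Graph (suc n)
extend A u v zero    zero    = false
extend A u v zero    (suc j) = ⌊ j ≟ u ⌋ ∨ ⌊ j ≟ v ⌋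
extend A u v (suc i) zero    = ⌊ i ≟ u ⌋ ∨ ⌊ i ≟ v ⌋
extend A u v (suc i) (suc j) = A i j

data TwoTree : (n : ℕ) → Graph n → Set where
  triangle : TwoTree 3 K3
  grow     : ∀ {n} {A : Graph n} → TwoTree n A →
             (u v : Fin n) → A u v ≡ true → TwoTree (suc n) (extend A u v)

countFin : ∀ {n} → (Fin n → Bool) → ℕ
countFin {n} p = sum (map (λ j → if p j then 1 else 0) (allFin n))

degree : ∀ {n} → Graph n → Fin n → ℕ
degree A i = countFin (A i)

-- G is a strong bicentral 2-tree-shaped graph with core {a,b} and maximum
-- degree Δ: a ≠ b, both have degree Δ, every other vertex has degree < Δ
-- (so Δ is the maximum degree and exactly two vertices attain it), and
-- the core induces K₂ (a adjacent to b).
StrongBicentral : ∀ {n} → Graph n → ℕ → Fin n → Fin n → Set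
StrongBicentral {n} A Δ a b =
  a ≢ b × degree A a ≡ Δ × degree A b ≡ Δ ×
  (∀ v → v ≢ a → v ≢ b → degree A v < Δ) × A a b ≡ true

TailSet23 : ∀ {n} → Graph n → Fin n → Fin n → Set
TailSet23 A a b = ∀ v → v ≢ a → v ≢ b → degree A v ≡ 2 ⊎ degree A v ≡ 3

sigma : ∀ {n} → Graph n → Fin n → Fin n → ℕ
sigma A a b = countFin (λ s →
  Data.Bool.not ⌊ s ≟ a ⌋ ∧ Data.Bool.not ⌊ s ≟ b ⌋ ∧ A a s ∧ A b s ∧ ⌊ degree A s N.≟ 3 ⌋)
  where import Data.Bool

{-# OPTIONS --safe #-}
-- Start from a triangle a b s₁ and attach a fan of K vertices x₁ … x_K at a,
-- xᵢ adjacent to a and x_{i−1} (x₀ = s₁). Then add a common neighbour s₂ of a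
-- and b with a fan of K − 1 vertices at b starting from s₂, and a common
-- neighbour s₃ with a fan of one vertex at b. The first fan vertex over each sᵢ
-- raises its degree to 3, so σ = 3, and every tail vertex has degree 2 or 3.
-- Now a and b both have degree K + 4; the remaining n − 5 − 2K vertices are
-- added as further common neighbours of a and b, raising both to n − 1 − K.
module Submission where

open import Defs
open import Data.Nat using (ℕ; _≤_; _∸_; _/_)
open import Data.Fin using (Fin)
open import Data.Product using (Σ; _×_; ∃-syntax)
open import Relation.Binary.PropositionalEquality using (_≡_)

open import Algebra.Bundles using (CommutativeMonoid)
open import Data.Bool using (Bool; true; false; _∧_; _∨_; not; if_then_else_)
open import Data.Bool.Properties using (∧-zeroʳ; ∧-identityʳ; ∨-zeroʳ; ∨-identityʳ; ∧-commutativeMonoid)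
open import Data.Fin using (zero; suc; _≟_)
open import Data.Fin.Properties using (suc-injective)
open import Data.List using (map; allFin; tabulate)
open import Data.List.Properties using (map-cong; map-tabulate)
open import Data.Nat using (zero; suc; _+_; _*_; _<_; s≤s; z≤n)
open import Data.Nat.DivMod using (m/n*n≤m)
open import Data.Nat.ListAction using (sum)
open import Data.Nat.Properties
  using (≤-trans; <⇒≤; m≤m+n; *-monoˡ-≤; m+n∸n≡m; m+[n∸m]≡n; m≤n⇒∃[o]m+o≡n; +-commutativeSemigroup)
open import Data.Nat.Tactic.RingSolver using (solve-∀)
open import Data.Product using (_,_; Σ-syntax)
open import Data.Sum using (_⊎_; inj₁; inj₂)
open import Function using (_∘_)
open import Relation.Nullary using (Dec; ¬_; yes; no; contradiction)
open import Relation.Nullary.Decidable using (⌊_⌋; isYes≗does; dec-true; dec-false; ⌊⌋-map′)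
open import Relation.Binary.PropositionalEquality using (_≢_; refl; sym; trans; cong; cong₂; module ≡-Reasoning)
import Algebra.Properties.CommutativeSemigroup as CommutativeSemigroupProperties
import Data.Nat as ℕ

open CommutativeSemigroupProperties +-commutativeSemigroup using () renaming (x∙yz≈y∙xz to +-left-comm)
open CommutativeSemigroupProperties (CommutativeMonoid.commutativeSemigroup ∧-commutativeMonoid)
  using () renaming (x∙yz≈y∙xz to ∧-left-comm)

private variable
  n : ℕ

⌊⌋-yes : ∀ {p} {P : Set p} (P? : Dec P) → P → ⌊ P? ⌋ ≡ true
⌊⌋-yes P? p = trans (isYes≗does P?) (dec-true P? p)

⌊⌋-no : ∀ {p} {P : Set p} (P? : Dec P) → ¬ P → ⌊ P? ⌋ ≡ false
⌊⌋-no P? ¬p = trans (isYes≗does P?) (dec-false P? ¬p)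

⌊≟⌋-sym : (i j : Fin n) → ⌊ i ≟ j ⌋ ≡ ⌊ j ≟ i ⌋
⌊≟⌋-sym i j with i ≟ j
... | yes i≡j = sym (⌊⌋-yes (j ≟ i) (sym i≡j))
... | no i≢j  = sym (⌊⌋-no (j ≟ i) (i≢j ∘ sym))

⌊suc≟suc⌋ : (i j : Fin n) → ⌊ suc i ≟ suc j ⌋ ≡ ⌊ i ≟ j ⌋
⌊suc≟suc⌋ i j = ⌊⌋-map′ _ _ (i ≟ j)

indicator : Bool → ℕ
indicator b = if b then 1 else 0

countFin-suc : (p : Fin (suc n) → Bool) → countFin p ≡ indicator (p zero) + countFin (p ∘ suc)
countFin-suc {n} p = cong (indicator (p zero) +_) (cong sum (begin
  map f (tabulate suc)        ≡⟨ map-tabulate suc f ⟩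
  tabulate (f ∘ suc)          ≡⟨ map-tabulate (λ i → i) (f ∘ suc) ⟨
  map (f ∘ suc) (allFin n)    ∎))
  where
  open ≡-Reasoning
  f = indicator ∘ p

countFin-cong : {p q : Fin n → Bool} → (∀ i → p i ≡ q i) → countFin p ≡ countFin q
countFin-cong {n} p≗q = cong sum (map-cong (cong indicator ∘ p≗q) (allFin n))

countFin-false : countFin {n} (λ _ → false) ≡ 0
countFin-false {zero}  = refl
countFin-false {suc n} = trans (countFin-suc {n} (λ _ → false)) (countFin-false {n})

countFin-insert : (p q : Fin n → Bool) (w : Fin n) → p w ≡ false → (∀ i → i ≢ w → p i ≡ q i) →
                  countFin q ≡ indicator (q w) + countFin p
countFin-insert {suc n} p q zero pw≡false p≗q
  rewrite countFin-suc p | countFin-suc q | pw≡false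
  = cong (indicator (q zero) +_) (countFin-cong (λ i → sym (p≗q (suc i) λ ())))
countFin-insert {suc n} p q (suc w) pw≡false p≗q
  rewrite countFin-suc p | countFin-suc q | p≗q zero (λ ())
  = trans (cong (indicator (q zero) +_) (countFin-insert (p ∘ suc) (q ∘ suc) w pw≡false
            (λ i i≢w → p≗q (suc i) (i≢w ∘ suc-injective))))
          (+-left-comm (indicator (q zero)) (indicator (q (suc w))) _)

countFin-≟ : (u : Fin n) → countFin (λ j → ⌊ j ≟ u ⌋) ≡ 1
countFin-≟ {suc n} zero    = trans (countFin-suc {n} (λ j → ⌊ j ≟ zero ⌋)) (cong suc (countFin-false {n}))
countFin-≟ {suc n} (suc u) =
  trans (countFin-suc {n} (λ j → ⌊ j ≟ suc u ⌋)) (trans (countFin-cong (λ j → ⌊suc≟suc⌋ j u)) (countFin-≟ u))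

countFin-≟-∨-≟ : {u v : Fin n} → u ≢ v → countFin (λ j → ⌊ j ≟ u ⌋ ∨ ⌊ j ≟ v ⌋) ≡ 2
countFin-≟-∨-≟ {u = u} {v} u≢v =
  trans (countFin-insert (λ j → ⌊ j ≟ u ⌋) _ v (⌊⌋-no (v ≟ u) (u≢v ∘ sym)) off-v)
        (cong₂ _+_ (cong indicator v∈) (countFin-≟ u))
  where
  off-v : ∀ i → i ≢ v → ⌊ i ≟ u ⌋ ≡ ⌊ i ≟ u ⌋ ∨ ⌊ i ≟ v ⌋
  off-v i i≢v rewrite ⌊⌋-no (i ≟ v) i≢v = sym (∨-identityʳ _)
  v∈ : ⌊ v ≟ u ⌋ ∨ ⌊ v ≟ v ⌋ ≡ true
  v∈ rewrite ⌊⌋-yes (v ≟ v) refl = ∨-zeroʳ _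

Symmetric : Graph n → Set
Symmetric G = ∀ i j → G i j ≡ G j i

extend-symmetric : {G : Graph n} → Symmetric G → ∀ u v → Symmetric (extend G u v)
extend-symmetric G-sym u v zero    zero    = refl
extend-symmetric G-sym u v zero    (suc j) = refl
extend-symmetric G-sym u v (suc i) zero    = refl
extend-symmetric G-sym u v (suc i) (suc j) = G-sym i j

twoTree-symmetric : {G : Graph n} → TwoTree n G → Symmetric G
twoTree-symmetric triangle i j = cong not (⌊≟⌋-sym i j)
twoTree-symmetric (grow T u v _) = extend-symmetric (twoTree-symmetric T) u v

extend-new-adjacent₁ : (G : Graph n) (u v : Fin n) → extend G u v (suc u) zero ≡ true
extend-new-adjacent₁ G u v rewrite ⌊⌋-yes (u ≟ u) refl = refl

extend-new-adjacent₂ : (G : Graph n) (u v : Fin n) → extend G u v (suc v) zero ≡ true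
extend-new-adjacent₂ G u v rewrite ⌊⌋-yes (v ≟ v) refl = ∨-zeroʳ _

extend-new-nonadjacent : (G : Graph n) {u v i : Fin n} → i ≢ u → i ≢ v → extend G u v (suc i) zero ≡ false
extend-new-nonadjacent G {u} {v} {i} i≢u i≢v rewrite ⌊⌋-no (i ≟ u) i≢u | ⌊⌋-no (i ≟ v) i≢v = refl

degree-extend-new : (G : Graph n) {u v : Fin n} → u ≢ v → degree (extend G u v) zero ≡ 2
degree-extend-new G {u} {v} u≢v = trans (countFin-suc (extend G u v zero)) (countFin-≟-∨-≟ u≢v)

degree-extend-old : (G : Graph n) (u v i : Fin n) →
                    degree (extend G u v) (suc i) ≡ indicator (⌊ i ≟ u ⌋ ∨ ⌊ i ≟ v ⌋) + degree G i
degree-extend-old G u v i = countFin-suc (extend G u v (suc i))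

degree-extend-end₁ : (G : Graph n) (u v : Fin n) → degree (extend G u v) (suc u) ≡ suc (degree G u)
degree-extend-end₁ G u v rewrite degree-extend-old G u v u | ⌊⌋-yes (u ≟ u) refl = refl

degree-extend-end₂ : (G : Graph n) (u v : Fin n) → degree (extend G u v) (suc v) ≡ suc (degree G v)
degree-extend-end₂ G u v rewrite degree-extend-old G u v v | ⌊⌋-yes (v ≟ v) refl | ∨-zeroʳ ⌊ v ≟ u ⌋ = refl

degree-extend-other : (G : Graph n) {u v i : Fin n} → i ≢ u → i ≢ v → degree (extend G u v) (suc i) ≡ degree G i
degree-extend-other G {u} {v} {i} i≢u i≢v
  rewrite degree-extend-old G u v i | ⌊⌋-no (i ≟ u) i≢u | ⌊⌋-no (i ≟ v) i≢v = refl

-- σ-vertex G a b s (degree G s) is the summand of sigma G a b at s; the degree is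
-- passed separately so that it can be taken in an extension of G.
σ-vertex : Graph n → Fin n → Fin n → Fin n → ℕ → Bool
σ-vertex G a b s d = not ⌊ s ≟ a ⌋ ∧ not ⌊ s ≟ b ⌋ ∧ G a s ∧ G b s ∧ ⌊ d ℕ.≟ 3 ⌋

σ-vertex-cong : (G : Graph n) {a b s : Fin n} {d d′ : ℕ} → (s ≢ a → s ≢ b → d ≡ d′) →
                σ-vertex G a b s d ≡ σ-vertex G a b s d′
σ-vertex-cong G {a} {b} {s} d≡d′ with s ≟ a | s ≟ b
... | yes _   | _       = refl
... | no _    | yes _   = refl
... | no s≢a  | no s≢b  = cong (λ d → G a s ∧ G b s ∧ ⌊ d ℕ.≟ 3 ⌋) (d≡d′ s≢a s≢b)

σ-vertex-tail : (G : Graph n) {a b s : Fin n} {d : ℕ} → s ≢ a → s ≢ b → G a s ≡ true →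
                σ-vertex G a b s d ≡ G b s ∧ ⌊ d ℕ.≟ 3 ⌋
σ-vertex-tail G {a} {b} {s} s≢a s≢b Gas rewrite ⌊⌋-no (s ≟ a) s≢a | ⌊⌋-no (s ≟ b) s≢b | Gas = refl

σ-vertex-comm : (G : Graph n) (a b s : Fin n) (d : ℕ) → σ-vertex G a b s d ≡ σ-vertex G b a s d
σ-vertex-comm G a b s d =
  trans (∧-left-comm (not ⌊ s ≟ a ⌋) (not ⌊ s ≟ b ⌋) (G a s ∧ G b s ∧ is3))
        (cong (not ⌊ s ≟ b ⌋ ∧_) (cong (not ⌊ s ≟ a ⌋ ∧_) (∧-left-comm (G a s) (G b s) is3)))
  where is3 = ⌊ d ℕ.≟ 3 ⌋

sigma-comm : (G : Graph n) (a b : Fin n) → sigma G a b ≡ sigma G b a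
sigma-comm G a b = countFin-cong λ s → σ-vertex-comm G a b s (degree G s)

sigma-extend : (G : Graph n) {u v : Fin n} (a b : Fin n) → u ≢ v →
               sigma (extend G u v) (suc a) (suc b)
                 ≡ countFin (λ s → σ-vertex G a b s (degree (extend G u v) (suc s)))
sigma-extend G {u} {v} a b u≢v =
  trans (countFin-suc (λ s → σ-vertex G′ (suc a) (suc b) s (degree G′ s)))
        (cong₂ _+_ (cong indicator new-vertex) (countFin-cong old-vertex))
  where
  G′ = extend G u v
  new-vertex : σ-vertex G′ (suc a) (suc b) zero (degree G′ zero) ≡ false
  new-vertex rewrite degree-extend-new G u≢v =
    trans (cong (G′ (suc a) zero ∧_) (∧-zeroʳ (G′ (suc b) zero))) (∧-zeroʳ _)
  old-vertex : ∀ s → σ-vertex G′ (suc a) (suc b) (suc s) (degree G′ (suc s))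
                   ≡ σ-vertex G a b s (degree G′ (suc s))
  old-vertex s rewrite ⌊suc≟suc⌋ s a | ⌊suc≟suc⌋ s b = refl

record Configuration (G : Graph n) (a b : Fin n) (da db σ : ℕ) : Set where
  field
    two-tree      : TwoTree n G
    core-distinct : a ≢ b
    core-edge     : G a b ≡ true
    degree-a      : degree G a ≡ da
    degree-b      : degree G b ≡ db
    tail-2-3      : TailSet23 G a b
    sigma≡        : sigma G a b ≡ σ

-- w is the end of the current fan at a: the next fan vertex is attached to the edge a w.
record Simplicial (G : Graph n) (a b w : Fin n) (c : Bool) : Set where
  field
    w≢a      : w ≢ a
    w≢b      : w ≢ b
    edge-a   : G a w ≡ true
    edge-b   : G b w ≡ c
    degree-w : degree G w ≡ 2

private variable
  G : Graph n
  a b w : Fin n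
  da db σ : ℕ
  c : Bool

swap-core : Configuration G a b da db σ → Configuration G b a db da σ
swap-core {G = G} {a = a} {b = b} C = record
  { two-tree      = two-tree
  ; core-distinct = core-distinct ∘ sym
  ; core-edge     = trans (twoTree-symmetric two-tree b a) core-edge
  ; degree-a      = degree-b
  ; degree-b      = degree-a
  ; tail-2-3      = λ v v≢b v≢a → tail-2-3 v v≢a v≢b
  ; sigma≡        = trans (sigma-comm G b a) sigma≡
  }
  where open Configuration C

common-neighbour-configuration : Configuration G a b da db σ →
  Configuration (extend G a b) (suc a) (suc b) (suc da) (suc db) σ ×
  Simplicial (extend G a b) (suc a) (suc b) zero true
common-neighbour-configuration {G = G} {a} {b} C =
  record
  { two-tree      = grow two-tree a b core-edge
  ; core-distinct = core-distinct ∘ suc-injective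
  ; core-edge     = core-edge
  ; degree-a      = trans (degree-extend-end₁ G a b) (cong suc degree-a)
  ; degree-b      = trans (degree-extend-end₂ G a b) (cong suc degree-b)
  ; tail-2-3      = tail
  ; sigma≡        = trans (sigma-extend G a b core-distinct)
                          (trans (countFin-cong λ s → σ-vertex-cong G (degree-extend-other G {u = a} {b} {s})) sigma≡)
  } ,
  record
  { w≢a      = λ ()
  ; w≢b      = λ ()
  ; edge-a   = extend-new-adjacent₁ G a b
  ; edge-b   = extend-new-adjacent₂ G a b
  ; degree-w = degree-extend-new G core-distinct
  }
  where
  open Configuration C
  tail : TailSet23 (extend G a b) (suc a) (suc b)
  tail zero    _       _       = inj₁ (degree-extend-new G core-distinct)
  tail (suc v) sv≢sa sv≢sb rewrite degree-extend-other G (sv≢sa ∘ cong suc) (sv≢sb ∘ cong suc) =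
    tail-2-3 v (sv≢sa ∘ cong suc) (sv≢sb ∘ cong suc)

fan-vertex-configuration : Configuration G a b da db σ → Simplicial G a b w c →
  Configuration (extend G a w) (suc a) (suc b) (suc da) db (indicator c + σ) ×
  Simplicial (extend G a w) (suc a) (suc b) zero false
fan-vertex-configuration {G = G} {a} {b} {w = w} {c} C S =
  record
  { two-tree      = grow two-tree a w edge-a
  ; core-distinct = core-distinct ∘ suc-injective
  ; core-edge     = core-edge
  ; degree-a      = trans (degree-extend-end₁ G a w) (cong suc degree-a)
  ; degree-b      = trans (degree-extend-other G (core-distinct ∘ sym) (w≢b ∘ sym)) degree-b
  ; tail-2-3      = tail
  ; sigma≡        = trans (sigma-extend G a b (w≢a ∘ sym))
                    (trans (countFin-insert _ _ w before-w unchanged) (cong₂ _+_ (cong indicator after-w) sigma≡))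
  } ,
  record
  { w≢a      = λ ()
  ; w≢b      = λ ()
  ; edge-a   = extend-new-adjacent₁ G a w
  ; edge-b   = extend-new-nonadjacent G (core-distinct ∘ sym) (w≢b ∘ sym)
  ; degree-w = degree-extend-new G (w≢a ∘ sym)
  }
  where
  open Configuration C
  open Simplicial S
  G′ = extend G a w
  degree-w′ : degree G′ (suc w) ≡ 3
  degree-w′ = trans (degree-extend-end₂ G a w) (cong suc degree-w)
  tail : TailSet23 G′ (suc a) (suc b)
  tail zero    _ _ = inj₁ (degree-extend-new G (w≢a ∘ sym))
  tail (suc v) sv≢sa sv≢sb = tail-old (sv≢sa ∘ cong suc) (sv≢sb ∘ cong suc) (v ≟ w)
    where
    tail-old : v ≢ a → v ≢ b → Dec (v ≡ w) → degree G′ (suc v) ≡ 2 ⊎ degree G′ (suc v) ≡ 3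
    tail-old _   _   (yes refl) = inj₂ degree-w′
    tail-old v≢a v≢b (no v≢w) rewrite degree-extend-other G v≢a v≢w = tail-2-3 v v≢a v≢b
  -- w is the only vertex whose σ-summand can change: its degree goes from 2 to 3.
  before-w : σ-vertex G a b w (degree G w) ≡ false
  before-w rewrite σ-vertex-tail G {d = degree G w} w≢a w≢b edge-a | degree-w = ∧-zeroʳ (G b w)
  after-w : σ-vertex G a b w (degree G′ (suc w)) ≡ c
  after-w rewrite σ-vertex-tail G {d = degree G′ (suc w)} w≢a w≢b edge-a | degree-w′ =
    trans (∧-identityʳ (G b w)) edge-b
  unchanged : ∀ s → s ≢ w → σ-vertex G a b s (degree G s) ≡ σ-vertex G a b s (degree G′ (suc s))
  unchanged s s≢w = σ-vertex-cong G (λ s≢a _ → sym (degree-extend-other G s≢a s≢w))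

Realisation : (n da db σ : ℕ) → Set
Realisation n da db σ = Σ[ G ∈ Graph n ] Σ[ a ∈ Fin n ] Σ[ b ∈ Fin n ] Configuration G a b da db σ

PointedRealisation : (n da db σ : ℕ) → Bool → Set
PointedRealisation n da db σ c =
  Σ[ G ∈ Graph n ] Σ[ a ∈ Fin n ] Σ[ b ∈ Fin n ] Σ[ w ∈ Fin n ] Configuration G a b da db σ × Simplicial G a b w c

triangle-realisation : PointedRealisation 3 2 2 0 true
triangle-realisation = K3 , zero , suc zero , suc (suc zero) ,
  record
  { two-tree      = triangle
  ; core-distinct = λ ()
  ; core-edge     = refl
  ; degree-a      = refl
  ; degree-b      = refl
  ; tail-2-3      = tail
  ; sigma≡        = refl
  } ,
  record { w≢a = λ () ; w≢b = λ () ; edge-a = refl ; edge-b = refl ; degree-w = refl }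
  where
  tail : TailSet23 K3 zero (suc zero)
  tail (suc (suc zero)) _ _ = inj₁ refl
  tail zero 0≢0 _ = contradiction refl 0≢0
  tail (suc zero) _ 1≢1 = contradiction refl 1≢1

swap : Realisation n da db σ → Realisation n db da σ
swap (G , a , b , C) = G , b , a , swap-core C

unpoint : PointedRealisation n da db σ c → Realisation n da db σ
unpoint (G , a , b , w , C , S) = G , a , b , C

add-common-neighbour : Realisation n da db σ → PointedRealisation (suc n) (suc da) (suc db) σ true
add-common-neighbour (G , a , b , C) = let C′ , S = common-neighbour-configuration C in _ , _ , _ , _ , C′ , S

add-fan-vertex : PointedRealisation n da db σ c → PointedRealisation (suc n) (suc da) db (indicator c + σ) false
add-fan-vertex (G , a , b , w , C , S) = let C′ , S′ = fan-vertex-configuration C S in _ , _ , _ , _ , C′ , S′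

add-common-neighbours : ∀ j → Realisation n da db σ → Realisation (j + n) (j + da) (j + db) σ
add-common-neighbours zero    = λ R → R
add-common-neighbours (suc j) = unpoint ∘ add-common-neighbour ∘ add-common-neighbours j

fan : ∀ t → PointedRealisation n da db σ c → PointedRealisation (suc t + n) (suc t + da) db (indicator c + σ) false
fan zero    = add-fan-vertex
fan (suc t) = add-fan-vertex ∘ fan t

cast-realisation : ∀ {n n′ da da′ db db′} → n ≡ n′ → da ≡ da′ → db ≡ db′ →
                   Realisation n da db σ → Realisation n′ da′ db′ σ
cast-realisation refl refl refl R = R

bicentral-realisation : ∀ K j → 2 ≤ K → Realisation (5 + (K * 2 + j)) (4 + (K + j)) (4 + (K + j)) 3
bicentral-realisation (suc (suc k)) j (s≤s (s≤s z≤n)) =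
  cast-realisation (vertices k j) (degree-a k j) (degree-b k j)
    ((add-common-neighbours j ∘ unpoint ∘ fan 0 ∘ add-common-neighbour ∘ unpoint ∘ fan k
      ∘ add-common-neighbour ∘ swap ∘ unpoint ∘ fan (suc k)) triangle-realisation)
  where
  vertices : ∀ x y → y + suc (suc (suc x + suc (suc (suc x) + 3))) ≡ 5 + (suc (suc x) * 2 + y)
  vertices = solve-∀
  degree-a : ∀ x y → y + suc (suc (suc x + 3)) ≡ 4 + (suc (suc x) + y)
  degree-a = solve-∀
  degree-b : ∀ x y → y + suc (suc (suc (suc x) + 2)) ≡ 4 + (suc (suc x) + y)
  degree-b = solve-∀

strong-bicentral : {G : Graph n} {a b : Fin n} {Δ : ℕ} → Configuration G a b Δ Δ σ → 4 ≤ Δ →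
                   TwoTree n G × StrongBicentral G Δ a b × TailSet23 G a b × sigma G a b ≡ σ
strong-bicentral {G = G} {a} {b} {Δ} C 4≤Δ =
  two-tree , (core-distinct , degree-a , degree-b , tail-degree< , core-edge) , tail-2-3 , sigma≡
  where
  open Configuration C
  tail-degree< : ∀ v → v ≢ a → v ≢ b → degree G v < Δ
  tail-degree< v v≢a v≢b with tail-2-3 v v≢a v≢b
  ... | inj₁ deg≡2 rewrite deg≡2 = <⇒≤ 4≤Δ
  ... | inj₂ deg≡3 rewrite deg≡3 = 4≤Δ

vertex-count : ∀ n K → 5 ≤ n → K ≤ (n ∸ 5) / 2 → ∃[ j ] 5 + (K * 2 + j) ≡ n
vertex-count n K 5≤n K≤[n∸5]/2 =
  let j , K*2+j≡n∸5 = m≤n⇒∃[o]m+o≡n (≤-trans (*-monoˡ-≤ 2 K≤[n∸5]/2) (m/n*n≤m (n ∸ 5) 2))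
  in  j , trans (cong (5 +_) K*2+j≡n∸5) (m+[n∸m]≡n 5≤n)

core-degree : ∀ K j → 5 + (K * 2 + j) ∸ 1 ∸ K ≡ 4 + (K + j)
core-degree K j = trans (cong (_∸ K) (rearrange K j)) (m+n∸n≡m (4 + (K + j)) K)
  where
  rearrange : ∀ x y → 4 + (x * 2 + y) ≡ 4 + (x + y) + x
  rearrange = solve-∀

lemma4p12 : (n K : ℕ) → 7 ≤ n → 2 ≤ K → K ≤ (n ∸ 5) / 2 →
    ∃[ A ] Σ (Fin n) (λ a → Σ (Fin n) (λ b →
      TwoTree n A × StrongBicentral A (n ∸ 1 ∸ K) a b × TailSet23 A a b × sigma A a b ≡ 3))
lemma4p12 n K 7≤n 2≤K K≤[n∸5]/2 with vertex-count n K (≤-trans (m≤m+n 5 2) 7≤n) K≤[n∸5]/2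
... | j , refl rewrite core-degree K j =
  let G , a , b , C = bicentral-realisation K j 2≤K
  in  G , a , b , strong-bicentral C (m≤m+n 4 (K + j))
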